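{- Every tree of pathwidth $k$ has a path-partition of height at most $2k$.
   Context: A path-partition of a tree $T$ is a pair $(\mathcal{T},\mathcal{P})$ where $\mathcal{T}$ is a rooted tree and $\mathcal{P}=\{P_x : x\in V(\mathcal{T})\}$ is a collection of vertex-disjoint paths of $T$ whose vertex sets partition $V(T)$, such that $xy\in E(\mathcal{T})$ if and only if $T$ has an edge between a vertex of $P_x$ and a vertex of $P_y$. The height of the path-partition is the height of $\mathcal{T}$, i.e. the maximum number of edges on a path from the root of $\mathcal{T}$ to a leaf. Pathwidth is the usual graph parameter. -}

module Defs where

open import Data.Nat using (ℕ; zero; suc; _≤_)
open import Data.Fin using (Fin) renaming (_≤_ to _≤ᶠ_)
open import Data.Fin.Subset using (Subset; _∈_; ∣_∣)
open import Data.List using (List; []; _∷_; _++_; [_]; length)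
open import Data.List.Relation.Unary.Linked using (Linked)
open import Data.List.Relation.Unary.Unique.Propositional using (Unique)
import Data.List.Membership.Propositional as LM
open import Data.Product using (Σ; ∃; ∃₂; _×_; _,_)
open import Data.Empty using (⊥)
open import Relation.Nullary using (¬_)
open import Relation.Binary.PropositionalEquality using (_≡_; _≢_)
open import Function.Bundles using (_⇔_)

record Graph (n : ℕ) : Set₁ where
  field
    Adj    : Fin n → Fin n → Set
    sym    : ∀ {u v} → Adj u v → Adj v u
    irrefl : ∀ {u} → ¬ Adj u u
open Graph public

data Walk {n : ℕ} (G : Graph n) : Fin n → Fin n → ℕ → Set where
  here : ∀ {u} → Walk G u u 0
  step : ∀ {u v w l} → Adj G u v → Walk G v w l → Walk G u w (suc l)

HeightAtMost : ∀ {p} (H : Graph p) → Fin p → ℕ → Set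
HeightAtMost H r h = ∀ x → ∃ λ l → l ≤ h × Walk H r x l

module _ {n : ℕ} (G : Graph n) where

  Connected : Set
  Connected = ∀ u v → ∃ λ l → Walk G u v l

  IsPath : List (Fin n) → Set
  IsPath vs = 1 ≤ length vs × Unique vs × Linked (Adj G) vs

  IsCycle : List (Fin n) → Set
  IsCycle vs = 3 ≤ length vs × Unique vs × Linked (Adj G) vs
             × ∃₂ λ u ws → ∃ λ w → vs ≡ u ∷ ws ++ [ w ] × Adj G w u

  Acyclic : Set
  Acyclic = ∀ vs → ¬ IsCycle vs

  IsTree : Set
  IsTree = 1 ≤ n × Connected × Acyclic

module _ {n : ℕ} (G : Graph n) where

  record PathDecomposition : Set where
    field
      m      : ℕ
      bag    : Fin m → Subset n
      cover  : ∀ v → ∃ λ i → v ∈ bag i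
      edges  : ∀ u v → Adj G u v → ∃ λ i → u ∈ bag i × v ∈ bag i
      interp : ∀ {i j l v} → i ≤ᶠ j → j ≤ᶠ l → v ∈ bag i → v ∈ bag l → v ∈ bag j
  open PathDecomposition public

  WidthAtMost : PathDecomposition → ℕ → Set
  WidthAtMost D k = ∀ i → ∣ bag D i ∣ ≤ suc k

  PathwidthIs : ℕ → Set
  PathwidthIs k = (Σ PathDecomposition λ D → WidthAtMost D k)
                × (∀ (D : PathDecomposition) → ∃ λ i → suc k ≤ ∣ bag D i ∣)

  record PathPartition : Set where
    field
      m       : ℕ
      part    : Fin n → Fin m
      isPath  : ∀ x → ∃ λ vs → IsPath G vs × (∀ v → (v LM.∈ vs) ⇔ (part v ≡ x))
  open PathPartition public

  quotientAdj : (P : PathPartition) → Fin (m P) → Fin (m P) → Set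
  quotientAdj P x y = x ≢ y × ∃₂ λ u v → part P u ≡ x × part P v ≡ y × Adj G u v

  quotient : (P : PathPartition) → Graph (m P)
  quotient P = record
    { Adj    = quotientAdj P
    ; sym    = λ { (x≢y , u , v , pu , pv , a) → (λ e → x≢y (symm e)) , v , u , pv , pu , sym G a }
    ; irrefl = λ { (x≢x , _) → x≢x Relation.Binary.PropositionalEquality.refl }
    }
    where
      symm = Relation.Binary.PropositionalEquality.sym

  HasPathPartitionOfHeightAtMost : ℕ → Set
  HasPathPartitionOfHeightAtMost h =
    Σ PathPartition λ P → IsTree (quotient P) × ∃ λ r → HeightAtMost (quotient P) r h

-- Root the tree T at ρ and fix a path decomposition of width at most k.  The
-- weight w(v) is the largest number of vertices of the subtree of v in one
-- bag, so 1 ≤ w(v) ≤ k + 1 and weights do not increase downwards.  Each vertex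
-- picks at most one heavy child of its own weight; the chains of heavy
-- children partition T into paths, and the quotient is a tree in which the
-- depth of a part is the number ld(v) of light vertices above its top v.
-- By the interval property, three subtrees of the weight of a common ancestor
-- cannot be pairwise separated; hence ld(v) + 2 w(v) ≤ 2 w(ρ) along root
-- paths, up to one extra unit after a split, which forces w(v) ≥ 2.  Thus
-- ld(v) ≤ 2k.
module Submission where

open import Defs renaming (sym to adj-sym; irrefl to adj-irrefl)
open import Data.Nat using (ℕ; zero; suc; _+_; _∸_; _*_; _⊔_; s≤s; z≤n; _≤?_; _≟_)
  renaming (_≤_ to _≤ₙ_; _<_ to _<ₙ_)
open import Data.Nat.Properties
open import Data.Nat.Tactic.RingSolver using (solve-∀)
open import Data.Fin using (Fin; zero; suc; toℕ; fromℕ<) renaming (_≤_ to _≤ᶠ_)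
open import Data.Fin.Properties using (any?; toℕ<n) renaming (_≟_ to _≟ᶠ_)
open import Data.Fin.Subset using (Subset; _∩_; ∣_∣; Nonempty) renaming (_∈_ to _∈ˢ_; _∉_ to _∉ˢ_)
open import Data.Fin.Subset.Properties
  using (p⊆q⇒∣p∣≤∣q∣; p⊂q⇒∣p∣<∣q∣; x∈p∩q⁺; x∈p∩q⁻; ∣p∩q∣≤∣p∣; nonempty?; Empty-unique; ∣⊥∣≡0;
         ∣⁅x⁆∣≡1; x≢y⇒x∉⁅y⁆; x∈⁅y⁆⇒x≡y)
open import Data.Vec using (tabulate)
open import Data.Vec.Properties using (lookup∘tabulate; lookup⇒[]=; []=⇒lookup)
open import Data.Bool using (true; if_then_else_)
open import Data.List using (List; []; _∷_; _++_; [_]; length; filter; allFin; reverse)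
open import Data.List.Properties using (length-++; reverse-++; unfold-reverse)
open import Data.List.Relation.Unary.All as All using (All; []; _∷_)
open import Data.List.Relation.Unary.All.Properties using (¬Any⇒All¬)
open import Data.List.Relation.Unary.Any as Any using (Any; here; there)
import Data.List.Relation.Unary.Any.Properties as AnyP
open import Data.List.Relation.Unary.Linked using (Linked; []; [-]; _∷_)
import Data.List.Relation.Unary.Linked as Linked
open import Data.List.Relation.Unary.Unique.Propositional using (Unique)
open import Data.List.Relation.Unary.Unique.Propositional.Properties using (filter⁺; allFin⁺)
open import Data.List.Relation.Unary.AllPairs using ([]; _∷_)
open import Data.List.Membership.Propositional using (_∈_)
open import Data.List.Membership.Propositional.Properties using (∈-filter⁺; ∈-filter⁻; ∈-allFin; ∈-lookup)
open import Data.Maybe using (Maybe; just; nothing; fromMaybe)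
open import Data.Maybe.Properties using (≡-dec; just-injective)
open import Data.Product using (Σ; ∃; _×_; _,_; proj₁; proj₂)
open import Data.Sum using (_⊎_; inj₁; inj₂)
open import Data.Empty using (⊥; ⊥-elim)
open import Function.Bundles using (mk⇔)
open import Function using (case_of_)
open import Relation.Nullary using (Dec; yes; no; does; ¬_)
open import Relation.Nullary.Decidable using (_⊎-dec_; _×-dec_; ¬?; dec-true; dec-false)
open import Relation.Binary.PropositionalEquality
  using (_≡_; _≢_; refl; sym; trans; cong; cong₂; subst; subst₂; setoid)
open import Relation.Binary.Construct.Closure.ReflexiveTransitive as Star
  using (Star; ε; _◅_; _◅◅_)
open import Data.List.Relation.Binary.Permutation.Propositional using (_↭_; ↭-sym; ↭⇒↭ₛ)
open import Data.List.Relation.Binary.Permutation.Propositional.Properties using (↭-reverse; All-resp-↭)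
import Data.List.Relation.Binary.Permutation.Setoid.Properties as PermutationSetoid

module SimplePaths {n : ℕ} (R : Fin n → Fin n → Set) where
  open import Data.List.Membership.DecPropositional (_≟ᶠ_ {n}) using (_∈?_)

  data PathR : Fin n → Fin n → List (Fin n) → Set where
    stop : ∀ {u} → PathR u u [ u ]
    _∷ₚ_ : ∀ {u v w xs} → R u v → PathR v w xs → PathR u w (u ∷ xs)

  infixr 5 _∷ₚ_

  path-linked : ∀ {u w xs} → PathR u w xs → Linked R xs
  path-linked stop = [-]
  path-linked (r ∷ₚ stop) = r ∷ [-]
  path-linked (r ∷ₚ r′ ∷ₚ p) = r ∷ path-linked (r′ ∷ₚ p)

  path-ends : ∀ {u w xs} → PathR u w xs → ∃ λ ys → xs ≡ ys ++ [ w ]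
  path-ends stop = [] , refl
  path-ends (_∷ₚ_ {u = u} r p) with path-ends p
  ... | ys , refl = u ∷ ys , refl

  suffix : ∀ {u w xs z} → PathR u w xs → Unique xs → z ∈ xs →
           ∃ λ ys → PathR z w ys × Unique ys
  suffix stop uq (here refl) = _ , stop , uq
  suffix (r ∷ₚ p) uq (here refl) = _ , r ∷ₚ p , uq
  suffix (r ∷ₚ p) (_ ∷ uq) (there z∈) = suffix p uq z∈

  shorten : ∀ {u w} → Star R u w → ∃ λ xs → PathR u w xs × Unique xs
  shorten {u} ε = [ u ] , stop , ([] ∷ [])
  shorten {u} (r ◅ q) with shorten q
  ... | ys , p , uq with u ∈? ys
  ...   | yes u∈ = suffix p uq u∈
  ...   | no u∉ = u ∷ ys , r ∷ₚ p , ¬Any⇒All¬ ys u∉ ∷ uq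

open SimplePaths using (PathR; stop; _∷ₚ_; shorten)

module _ {n : ℕ} (G : Graph n) (acyclic : Acyclic G) where

  no-closed-path : ∀ {R : Fin n → Fin n → Set} → (∀ {a b} → R a b → Adj G a b) →
                   ∀ {u v x w xs} (r : R u v) (r′ : R v x) (p : PathR R x w xs) →
                   Unique (u ∷ v ∷ xs) → Adj G w u → ⊥
  no-closed-path {R} R⊆G {u} {v} {w = w} r r′ p uq a with SimplePaths.path-ends R p
  ... | ys , refl = acyclic _ (three , uq , Linked.map R⊆G (SimplePaths.path-linked R (r ∷ₚ r′ ∷ₚ p)) ,
                               u , v ∷ ys , w , refl , a)
    where
    three : 3 ≤ₙ length (u ∷ v ∷ ys ++ [ w ])
    three = s≤s (s≤s (subst (1 ≤ₙ_) (sym (length-++ ys)) (m≤n+m 1 (length ys))))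

least : (P : ℕ → Set) → (∀ d → Dec (P d)) → ∀ l → P l →
        Σ ℕ λ d → P d × (∀ e → e <ₙ d → ¬ P e)
least P P? zero p = zero , p , λ _ ()
least P P? (suc l) p with P? zero
... | yes p0 = zero , p0 , λ _ ()
... | no ¬p0 with least (λ d → P (suc d)) (λ d → P? (suc d)) l p
...   | d , pd , below = suc d , pd , below′
  where
  below′ : ∀ e → e <ₙ suc d → ¬ P e
  below′ zero _ = ¬p0
  below′ (suc e) (s≤s e<d) = below e e<d

witness? : ∀ {A : Set} {P : A → Set} → Dec (∃ P) → Maybe A
witness? (yes (a , _)) = just a
witness? (no _) = nothing

witness?-spec : ∀ {A : Set} {P : A → Set} (d : Dec (∃ P)) →
                (witness? d ≡ nothing × ¬ ∃ P) ⊎ (∃ λ a → witness? d ≡ just a × P a)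
witness?-spec (yes (a , pa)) = inj₂ (a , refl , pa)
witness?-spec (no ¬p) = inj₁ (refl , ¬p)

maxOver : ∀ {M} → (Fin M → ℕ) → ℕ
maxOver {zero} f = 0
maxOver {suc M} f = f zero ⊔ maxOver (λ i → f (suc i))

≤-maxOver : ∀ {M} (f : Fin M → ℕ) i → f i ≤ₙ maxOver f
≤-maxOver f zero = m≤m⊔n _ _
≤-maxOver f (suc i) = ≤-trans (≤-maxOver (λ j → f (suc j)) i) (m≤n⊔m _ _)

maxOver-lub : ∀ {M} (f : Fin M → ℕ) c → (∀ i → f i ≤ₙ c) → maxOver f ≤ₙ c
maxOver-lub {zero} f c h = z≤n
maxOver-lub {suc M} f c h = ⊔-lub (h zero) (maxOver-lub (λ j → f (suc j)) c (λ j → h (suc j)))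

maxOver-attained : ∀ {M} (f : Fin M → ℕ) → Fin M → ∃ λ j → maxOver f ≡ f j
maxOver-attained {suc zero} f _ = zero , ⊔-identityʳ (f zero)
maxOver-attained {suc (suc M)} f _
  with ≤-total (f zero) (maxOver (λ i → f (suc i))) | maxOver-attained {suc M} (λ i → f (suc i)) zero
... | inj₁ le | j , eq = suc j , trans (m≤n⇒m⊔n≡n le) eq
... | inj₂ ge | _ = zero , m≥n⇒m⊔n≡m ge

fromDoes : ∀ {P : Set} (d : Dec P) → does d ≡ true → P
fromDoes (yes p) _ = p
fromDoes (no _) ()

subsetOf : ∀ {n} {P : Fin n → Set} → (∀ x → Dec (P x)) → Subset n
subsetOf P? = tabulate (λ x → does (P? x))

∈-subsetOf⁺ : ∀ {n} {P : Fin n → Set} (P? : ∀ x → Dec (P x)) {x} → P x → x ∈ˢ subsetOf P?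
∈-subsetOf⁺ P? {x} p = lookup⇒[]= x _ (trans (lookup∘tabulate _ x) (dec-true (P? x) p))

∈-subsetOf⁻ : ∀ {n} {P : Fin n → Set} (P? : ∀ x → Dec (P x)) {x} → x ∈ˢ subsetOf P? → P x
∈-subsetOf⁻ P? {x} m = fromDoes (P? x) (trans (sym (lookup∘tabulate _ x)) ([]=⇒lookup m))

potential-drop : ∀ l a b W → suc a ≤ₙ b → l + (b + b) ≤ₙ suc W → suc l + (a + a) ≤ₙ W
potential-drop l a b W a<b bound = +-cancelʳ-≤ 1 _ W (begin
  suc l + (a + a) + 1   ≡⟨ rearrange l a ⟩
  l + (suc a + suc a)   ≤⟨ +-monoʳ-≤ l (+-mono-≤ a<b a<b) ⟩
  l + (b + b)           ≤⟨ bound ⟩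
  suc W                 ≡⟨ +-comm 1 W ⟩
  W + 1                 ∎)
  where
  open ≤-Reasoning
  rearrange : ∀ l a → suc l + (a + a) + 1 ≡ l + (suc a + suc a)
  rearrange = solve-∀

height-estimate : ∀ l a b k e → suc e ≤ₙ a → b ≤ₙ suc k → l + (a + a) ≤ₙ e + (b + b) → l ≤ₙ k + k
height-estimate l a b k e e<a b≤ bound = ≤-trans (m≤m+n l e) (+-cancelʳ-≤ (2 + e) (l + e) (k + k) (begin
  l + e + (2 + e)             ≡⟨ left l e ⟩
  l + (suc e + suc e)         ≤⟨ +-monoʳ-≤ l (+-mono-≤ e<a e<a) ⟩
  l + (a + a)                 ≤⟨ bound ⟩
  e + (b + b)                 ≤⟨ +-monoʳ-≤ e (+-mono-≤ b≤ b≤) ⟩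
  e + (suc k + suc k)         ≡⟨ right k e ⟩
  k + k + (2 + e)             ∎))
  where
  open ≤-Reasoning
  left : ∀ l e → l + e + (2 + e) ≡ l + (suc e + suc e)
  left = solve-∀
  right : ∀ k e → e + (suc k + suc k) ≡ k + k + (2 + e)
  right = solve-∀

module _ {n : ℕ} (B : Subset n) {X Y : Subset n} (X⊆Y : ∀ {x} → x ∈ˢ X → x ∈ˢ Y) where

  ∩-mono : ∀ {x} → x ∈ˢ B ∩ X → x ∈ˢ B ∩ Y
  ∩-mono m = let (b , x) = x∈p∩q⁻ B X m in x∈p∩q⁺ (b , X⊆Y x)

  ∣∩∣-mono : ∣ B ∩ X ∣ ≤ₙ ∣ B ∩ Y ∣
  ∣∩∣-mono = p⊆q⇒∣p∣≤∣q∣ ∩-mono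

  ∣∩∣-strict : ∀ {y} → y ∈ˢ B → y ∈ˢ Y → y ∉ˢ X → ∣ B ∩ X ∣ <ₙ ∣ B ∩ Y ∣
  ∣∩∣-strict {y} yB yY y∉X = p⊂q⇒∣p∣<∣q∣ (∩-mono , y , x∈p∩q⁺ (yB , yY) , λ m → y∉X (proj₂ (x∈p∩q⁻ B X m)))

one≤∣∣ : ∀ {n} (X : Subset n) {y} → y ∈ˢ X → 1 ≤ₙ ∣ X ∣
one≤∣∣ X {y} y∈ = subst (_≤ₙ ∣ X ∣) (∣⁅x⁆∣≡1 y) (p⊆q⇒∣p∣≤∣q∣ λ z → subst (_∈ˢ X) (sym (x∈⁅y⁆⇒x≡y y z)) y∈)

two≤∣∣ : ∀ {n} (X : Subset n) {y z} → y ∈ˢ X → z ∈ˢ X → z ≢ y → 2 ≤ₙ ∣ X ∣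
two≤∣∣ X {y} {z} y∈ z∈ z≢y = subst (λ t → suc t ≤ₙ ∣ X ∣) (∣⁅x⁆∣≡1 y)
  (p⊂q⇒∣p∣<∣q∣ ((λ q → subst (_∈ˢ X) (sym (x∈⁅y⁆⇒x≡y y q)) y∈) , z , z∈ , x≢y⇒x∉⁅y⁆ z≢y))

1≤∣∣⇒nonempty : ∀ {n} (X : Subset n) → 1 ≤ₙ ∣ X ∣ → Nonempty X
1≤∣∣⇒nonempty {n} X le with nonempty? X
... | yes ne = ne
... | no e = ⊥-elim (1+n≰n {0} (subst (1 ≤ₙ_) (trans (cong ∣_∣ (Empty-unique e)) (∣⊥∣≡0 n)) le))

module _ {A : Set} where

  lastOf : A → List A → A
  lastOf a [] = a
  lastOf a (b ∷ bs) = lastOf b bs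

  lastOf-snoc : ∀ (a : A) xs w → lastOf a (xs ++ [ w ]) ≡ w
  lastOf-snoc a [] w = refl
  lastOf-snoc a (x ∷ xs) w = lastOf-snoc x xs w

  length-snoc : ∀ (xs : List A) w → length (xs ++ [ w ]) ≡ suc (length xs)
  length-snoc xs w = trans (length-++ xs) (+-comm (length xs) 1)

  reverse-ends : ∀ (a : A) xs w → reverse (a ∷ xs ++ [ w ]) ≡ w ∷ reverse xs ++ [ a ]
  reverse-ends a xs w = trans (reverse-++ (a ∷ xs) [ w ]) (cong (w ∷_) (unfold-reverse a xs))

  reverse-ends-↭ : ∀ (a : A) xs w → a ∷ xs ++ [ w ] ↭ w ∷ reverse xs ++ [ a ]
  reverse-ends-↭ a xs w = subst (a ∷ xs ++ [ w ] ↭_) (reverse-ends a xs w) (↭-sym (↭-reverse _))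

  unique-↭ : ∀ {xs ys} → xs ↭ ys → Unique xs → Unique ys
  unique-↭ p = PermutationSetoid.Unique-resp-↭ (setoid A) (↭⇒↭ₛ p)

  module _ {R : A → A → Set} (R-sym : ∀ {a b} → R a b → R b a) where

    linked-reverseAcc : ∀ x xs acc → Linked R (x ∷ xs) → Linked R (x ∷ acc) →
                        Linked R (Data.List.reverseAcc (x ∷ acc) xs)
    linked-reverseAcc x [] acc _ l = l
    linked-reverseAcc x (y ∷ ys) acc (r ∷ l₁) l₂ = linked-reverseAcc y ys (x ∷ acc) l₁ (R-sym r ∷ l₂)

    linked-reverse : ∀ xs → Linked R xs → Linked R (reverse xs)
    linked-reverse [] l = []
    linked-reverse (x ∷ xs) l = linked-reverseAcc x xs [] l [-]

module _ {p : ℕ} {G : Graph p} where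

  walk-++ : ∀ {a b c l₁ l₂} → Walk G a b l₁ → Walk G b c l₂ → Walk G a c (l₁ + l₂)
  walk-++ here q = q
  walk-++ (step e p) q = step e (walk-++ p q)

  walk-snoc : ∀ {a b c l} → Walk G a b l → Adj G b c → Walk G a c (suc l)
  walk-snoc {l = l} p e = subst (Walk G _ _) (+-comm l 1) (walk-++ p (step e here))

  walk-reverse : ∀ {a b l} → Walk G a b l → Walk G b a l
  walk-reverse here = here
  walk-reverse (step e p) = walk-snoc (walk-reverse p) (adj-sym G e)

  walk⇒star : ∀ {a b l} → Walk G a b l → Star (Adj G) a b
  walk⇒star here = ε
  walk⇒star (step e p) = e ◅ walk⇒star p

-- Graphs all of whose edges join a vertex to its parent, one level higher,
-- are acyclic: along a simple path heights first decrease and then increase,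
-- which is incompatible with closing a cycle.

module ParentGraph {p : ℕ} (G : Graph p) (up : Fin p → Fin p) (ht : Fin p → ℕ) where

  ParentOf : Fin p → Fin p → Set
  ParentOf x y = x ≡ up y × ht y ≡ suc (ht x)

  module _ (edge-dir : ∀ {x y} → Adj G x y → ParentOf x y ⊎ ParentOf y x) where

    -- After a step down along a simple path, all later steps go down too:
    -- a step up would return to the parent, which was already visited.
    descend : ∀ {x y} zs → Linked (Adj G) (x ∷ y ∷ zs) → Unique (x ∷ y ∷ zs) → ParentOf x y →
              ht (lastOf y zs) ≡ ht x + suc (length zs)
    descend {x} [] _ _ (_ , hy) = trans hy (+-comm 1 (ht x))
    descend {x} {y} (z ∷ zs) (_ ∷ y~z ∷ lk) ((_ ∷ x≢z ∷ _) ∷ uq) (x≡up , hy) with edge-dir y~z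
    ... | inj₁ yz = trans (descend zs (y~z ∷ lk) uq yz)
                      (trans (cong (_+ suc (length zs)) hy) (sym (+-suc (ht x) (suc (length zs)))))
    ... | inj₂ (z≡up , _) = ⊥-elim (x≢z (trans x≡up (sym z≡up)))

    down-cycle : ∀ {u a w} ws → Linked (Adj G) (u ∷ a ∷ ws ++ [ w ]) → Unique (u ∷ a ∷ ws ++ [ w ]) →
                 ParentOf u a → Adj G w u → ⊥
    down-cycle {u} {a} {w} ws lk uq ua wu = closing (edge-dir wu)
      where
      far : ht w ≡ ht u + suc (suc (length ws))
      far = subst₂ (λ z L → ht z ≡ ht u + suc L) (lastOf-snoc a ws w) (length-snoc ws w)
                   (descend (ws ++ [ w ]) lk uq ua)
      gap : suc (suc (ht u)) ≤ₙ ht w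
      gap = ≤-trans (≤-reflexive (+-comm 2 (ht u)))
                    (≤-trans (+-monoʳ-≤ (ht u) (s≤s (s≤s z≤n))) (≤-reflexive (sym far)))
      closing : ParentOf w u ⊎ ParentOf u w → ⊥
      closing (inj₁ (_ , hu)) = 1+n≰n (≤-trans (≤-reflexive (sym hu)) (≤-trans (n≤1+n _) (≤-trans (n≤1+n _) gap)))
      closing (inj₂ (_ , hw)) = 1+n≰n (≤-trans gap (≤-reflexive hw))

    -- A cycle starting with a step up either closes with a step down, so its
    -- reversal starts with a step down, or revisits the parent.
    acyclic : Acyclic G
    acyclic _ (len , uq , lk , u , ws , w , refl , wu) = cycle ws len uq lk
      where
      cycle : ∀ ws → 3 ≤ₙ length (u ∷ ws ++ [ w ]) → Unique (u ∷ ws ++ [ w ]) →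
              Linked (Adj G) (u ∷ ws ++ [ w ]) → ⊥
      cycle [] (s≤s (s≤s ()))
      cycle (a ∷ ws) _ uq lk@(u~a ∷ lk′) with edge-dir u~a
      ... | inj₁ ua = down-cycle ws lk uq ua wu
      ... | inj₂ (a≡up , _) with edge-dir wu | uq
      ...   | inj₁ (w≡up , _) | _ ∷ (a∉ ∷ _) = All.lookup a∉ (AnyP.++⁺ʳ ws (here refl)) (trans a≡up (sym w≡up))
      ...   | inj₂ uw | u∉ ∷ uq′ =
        down-cycle (reverse ws)
          (adj-sym G wu ∷ subst (Linked (Adj G)) (reverse-ends a ws w) (linked-reverse (adj-sym G) _ lk′))
          (All-resp-↭ (reverse-ends-↭ a ws w) u∉ ∷ unique-↭ (reverse-ends-↭ a ws w) uq′)
          uw (adj-sym G u~a)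

module _ {n : ℕ} (G : Graph n) where

  Inside : (Fin n → Set) → Fin n → Fin n → Set
  Inside Q x y = Q x × Q y × Adj G x y

  inside-sym : ∀ {Q x y} → Inside Q x y → Inside Q y x
  inside-sym (qx , qy , a) = qy , qx , adj-sym G a

  inside-mono : ∀ {Q Q′ : Fin n → Set} → (∀ {z} → Q z → Q′ z) → ∀ {x y} → Inside Q x y → Inside Q′ x y
  inside-mono f (qx , qy , a) = f qx , f qy , a

module Interval {n : ℕ} (G : Graph n) (D : PathDecomposition G) where

  bagOf : Fin (PathDecomposition.m D) → Subset n
  bagOf = PathDecomposition.bag D

  Between : ∀ {M} → Fin M → Fin M → Fin M → Set
  Between i j l = (i ≤ᶠ j × j ≤ᶠ l) ⊎ (l ≤ᶠ j × j ≤ᶠ i)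

  some-between : ∀ {M} (a b c : Fin M) → Between a b c ⊎ Between b a c ⊎ Between a c b
  some-between a b c with ≤-total (toℕ a) (toℕ b) | ≤-total (toℕ b) (toℕ c) | ≤-total (toℕ a) (toℕ c)
  ... | inj₁ ab | inj₁ bc | _ = inj₁ (inj₁ (ab , bc))
  ... | inj₁ ab | inj₂ cb | inj₁ ac = inj₂ (inj₂ (inj₁ (ac , cb)))
  ... | inj₁ ab | inj₂ cb | inj₂ ca = inj₂ (inj₁ (inj₂ (ca , ab)))
  ... | inj₂ ba | inj₁ bc | inj₁ ac = inj₂ (inj₁ (inj₁ (ba , ac)))
  ... | inj₂ ba | inj₁ bc | inj₂ ca = inj₂ (inj₂ (inj₂ (bc , ca)))
  ... | inj₂ ba | inj₂ cb | _ = inj₁ (inj₂ (cb , ba))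

  module _ {Q : Fin n → Set} where

    -- Follow the walk while its next edge lies in a bag before j; the first
    -- vertex whose next edge lies in a bag at or after j is in bag j.
    interval-≤ : ∀ {a b} → Star (Inside G Q) a b → Q a → ∀ {i j l} →
                 a ∈ˢ bagOf i → b ∈ˢ bagOf l → i ≤ᶠ j → j ≤ᶠ l → ∃ λ z → Q z × z ∈ˢ bagOf j
    interval-≤ ε qa a∈ b∈ ij jl = _ , qa , PathDecomposition.interp D ij jl a∈ b∈
    interval-≤ {a} (_◅_ {j = c} (_ , qc , a~c) rest) qa {j = j} a∈ b∈ ij jl
      with PathDecomposition.edges D a c a~c
    ... | e , a∈e , c∈e with toℕ j ≤? toℕ e
    ...   | yes je = a , qa , PathDecomposition.interp D ij je a∈ a∈e
    ...   | no j≰e = interval-≤ rest qc c∈e b∈ (<⇒≤ (≰⇒> j≰e)) jl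

    target-inside : ∀ {a b} → Star (Inside G Q) a b → Q a → Q b
    target-inside ε qa = qa
    target-inside ((_ , qc , _) ◅ rest) _ = target-inside rest qc

    interval : ∀ {a b} → Star (Inside G Q) a b → Q a → ∀ {i j l} →
               a ∈ˢ bagOf i → b ∈ˢ bagOf l → Between i j l → ∃ λ z → Q z × z ∈ˢ bagOf j
    interval walk qa a∈ b∈ (inj₁ (ij , jl)) = interval-≤ walk qa a∈ b∈ ij jl
    interval walk qa a∈ b∈ (inj₂ (lj , ji)) =
      interval-≤ (Star.reverse (inside-sym G) walk) (target-inside walk qa) b∈ a∈ lj ji

-- Rooting a tree: depth, parent and the ancestor order

module RootedTree {n : ℕ} (T : Graph n) (tree : IsTree T) where

  connected : Connected T
  connected = proj₁ (proj₂ tree)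

  acyclic : Acyclic T
  acyclic = proj₂ (proj₂ tree)

  ρ : Fin n
  ρ = fromℕ< (proj₁ tree)

  -- Adjacency is decidable: two vertices are adjacent iff the simple path
  -- obtained by shortening a walk between them is a single edge.
  adjacent? : ∀ u v → Dec (Adj T u v)
  adjacent? u v with shorten (Adj T) (walk⇒star (proj₂ (connected u v)))
  ... | _ , stop , _ = no (adj-irrefl T)
  ... | _ , r ∷ₚ stop , _ = yes r
  ... | _ , r ∷ₚ r′ ∷ₚ p , uq = no λ a → no-closed-path T acyclic (λ e → e) r r′ p uq (adj-sym T a)

  Near : ℕ → Fin n → Set
  Near zero v = v ≡ ρ
  Near (suc d) v = Near d v ⊎ ∃ λ u → Near d u × Adj T u v

  near? : ∀ d v → Dec (Near d v)
  near? zero v = v ≟ᶠ ρ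
  near? (suc d) v = near? d v ⊎-dec any? (λ u → near? d u ×-dec adjacent? u v)

  walk-near : ∀ {u v l} → Walk T u v l → ∀ d → Near d u → Near (d + l) v
  walk-near here d r rewrite +-identityʳ d = r
  walk-near {l = suc l} (step a walk) d r rewrite +-suc d l = walk-near walk (suc d) (inj₂ (_ , r , a))

  opaque
    depthSpec : ∀ v → Σ ℕ λ d → Near d v × (∀ e → e <ₙ d → ¬ Near e v)
    depthSpec v = least (λ d → Near d v) (λ d → near? d v) (proj₁ (connected ρ v))
                        (walk-near (proj₂ (connected ρ v)) 0 refl)

    depth : Fin n → ℕ
    depth v = proj₁ (depthSpec v)

    depth-near : ∀ v → Near (depth v) v
    depth-near v = proj₁ (proj₂ (depthSpec v))

    depth-least : ∀ v e → Near e v → depth v ≤ₙ e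
    depth-least v e r with depth v ≤? e
    ... | yes le = le
    ... | no nle = ⊥-elim (proj₂ (proj₂ (depthSpec v)) e (≰⇒> nle) r)

  depth-ρ : depth ρ ≡ 0
  depth-ρ = n≤0⇒n≡0 (depth-least ρ 0 refl)

  depth-zero : ∀ {v} → depth v ≡ 0 → v ≡ ρ
  depth-zero {v} e = subst (λ d → Near d v) e (depth-near v)

  Upward : Fin n → Fin n → Set
  Upward v u = Near (depth v ∸ 1) u × Adj T u v

  upward-exists : ∀ v → v ≢ ρ → ∃ (Upward v)
  upward-exists v v≢ρ with depth v in eq | depth-near v
  ... | zero | _ = ⊥-elim (v≢ρ (depth-zero eq))
  ... | suc d | inj₁ r = ⊥-elim (1+n≰n (≤-trans (≤-reflexive (sym eq)) (depth-least v d r)))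
  ... | suc d | inj₂ (u , r , a) = u , r , a

  opaque
    -- The parent of v ≠ ρ is an upward neighbour (the value at ρ is irrelevant).
    parent : Fin n → Fin n
    parent v = fromMaybe ρ (witness? (any? (λ u → near? (depth v ∸ 1) u ×-dec adjacent? u v)))

    parent-upward : ∀ v → v ≢ ρ → Upward v (parent v)
    parent-upward v v≢ρ with witness?-spec (any? (λ u → near? (depth v ∸ 1) u ×-dec adjacent? u v))
    ... | inj₁ (_ , none) = ⊥-elim (none (upward-exists v v≢ρ))
    ... | inj₂ (u , e , up) = subst (Upward v) (sym (cong (fromMaybe ρ) e)) up

  parent-adj : ∀ v → v ≢ ρ → Adj T (parent v) v
  parent-adj v v≢ρ = proj₂ (parent-upward v v≢ρ)

  depth-parent : ∀ v → v ≢ ρ → depth v ≡ suc (depth (parent v))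
  depth-parent v v≢ρ with depth v in eq
  ... | zero = ⊥-elim (v≢ρ (depth-zero eq))
  ... | suc d = cong suc (≤-antisym lower upper)
    where
    upper : depth (parent v) ≤ₙ d
    upper = depth-least (parent v) d (subst (λ x → Near (x ∸ 1) (parent v)) eq (proj₁ (parent-upward v v≢ρ)))
    lower : d ≤ₙ depth (parent v)
    lower = ≤-pred (subst (_≤ₙ suc (depth (parent v))) eq
              (depth-least v _ (inj₂ (parent v , depth-near (parent v) , parent-adj v v≢ρ))))

  depth-ind : (P : Fin n → Set) → (∀ v → (v ≢ ρ → P (parent v)) → P v) → ∀ v → P v
  depth-ind P from-parent v = go (depth v) v refl
    where
    go : ∀ m v → depth v ≡ m → P v
    go zero v e = from-parent v (λ v≢ρ → ⊥-elim (v≢ρ (depth-zero e)))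
    go (suc m) v e = from-parent v (λ v≢ρ → go m (parent v) (suc-injective (trans (sym (depth-parent v v≢ρ)) e)))

  ChildOf : Fin n → Fin n → Set
  ChildOf c p = c ≢ ρ × parent c ≡ p

  -- Every edge of the tree joins a vertex and its parent: otherwise the two
  -- root paths of its ends contain a simple path closed by the edge.
  TreeEdge : Fin n → Fin n → Set
  TreeEdge x y = ChildOf x y ⊎ ChildOf y x

  tree-edge-sym : ∀ {x y} → TreeEdge x y → TreeEdge y x
  tree-edge-sym (inj₁ e) = inj₂ e
  tree-edge-sym (inj₂ e) = inj₁ e

  tree-edge-adj : ∀ {x y} → TreeEdge x y → Adj T x y
  tree-edge-adj (inj₁ (x≢ρ , refl)) = adj-sym T (parent-adj _ x≢ρ)
  tree-edge-adj (inj₂ (y≢ρ , refl)) = parent-adj _ y≢ρ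

  to-root : ∀ v → Star TreeEdge v ρ
  to-root = depth-ind (λ v → Star TreeEdge v ρ) from-parent
    where
    from-parent : ∀ v → (v ≢ ρ → Star TreeEdge (parent v) ρ) → Star TreeEdge v ρ
    from-parent v ih with v ≟ᶠ ρ
    ... | yes refl = ε
    ... | no v≢ρ = inj₁ (v≢ρ , refl) ◅ ih v≢ρ

  tree-edge : ∀ {u v} → Adj T u v → TreeEdge u v
  tree-edge {u} {v} a with shorten TreeEdge (to-root u ◅◅ Star.reverse tree-edge-sym (to-root v))
  ... | _ , stop , _ = ⊥-elim (adj-irrefl T a)
  ... | _ , r ∷ₚ stop , _ = r
  ... | _ , r ∷ₚ r′ ∷ₚ p , uq = ⊥-elim (no-closed-path T acyclic tree-edge-adj r r′ p uq (adj-sym T a))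

  -- a ≼ x : a lies on the path from x to the root, i.e. x is in the subtree of a.
  infix 4 _≼_
  data _≼_ (a : Fin n) : Fin n → Set where
    ≼-refl : a ≼ a
    ≼-step : ∀ {x} → x ≢ ρ → a ≼ parent x → a ≼ x

  parent-≼ : ∀ {x} → x ≢ ρ → parent x ≼ x
  parent-≼ x≢ρ = ≼-step x≢ρ ≼-refl

  child-≼ : ∀ {c p} → ChildOf c p → p ≼ c
  child-≼ (c≢ρ , refl) = parent-≼ c≢ρ

  ≼-trans : ∀ {a b c} → a ≼ b → b ≼ c → a ≼ c
  ≼-trans ab ≼-refl = ab
  ≼-trans ab (≼-step c≢ρ bc) = ≼-step c≢ρ (≼-trans ab bc)

  ≼-depth : ∀ {a x} → a ≼ x → depth a ≤ₙ depth x
  ≼-depth ≼-refl = ≤-refl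
  ≼-depth (≼-step x≢ρ ax) = ≤-trans (≼-depth ax) (≤-trans (n≤1+n _) (≤-reflexive (sym (depth-parent _ x≢ρ))))

  child-⋠ : ∀ {c p} → ChildOf c p → ¬ (c ≼ p)
  child-⋠ (c≢ρ , refl) c≼p = 1+n≰n (≤-trans (≤-reflexive (sym (depth-parent _ c≢ρ))) (≼-depth c≼p))

  ≼-depth-≡ : ∀ {a x} → a ≼ x → depth x ≤ₙ depth a → a ≡ x
  ≼-depth-≡ ≼-refl _ = refl
  ≼-depth-≡ (≼-step x≢ρ ax) le =
    ⊥-elim (1+n≰n (≤-trans (≤-trans (s≤s (≼-depth ax)) (≤-reflexive (sym (depth-parent _ x≢ρ)))) le))

  ≼-inv : ∀ {a x} → a ≼ x → a ≢ x → x ≢ ρ × a ≼ parent x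
  ≼-inv ≼-refl a≢x = ⊥-elim (a≢x refl)
  ≼-inv (≼-step x≢ρ ax) _ = x≢ρ , ax

  ≼-comparable : ∀ {a b x} → a ≼ x → b ≼ x → depth a ≤ₙ depth b → a ≼ b
  ≼-comparable ax ≼-refl _ = ax
  ≼-comparable ≼-refl (≼-step x≢ρ bx) le =
    ⊥-elim (1+n≰n (≤-trans (≤-reflexive (sym (depth-parent _ x≢ρ))) (≤-trans le (≼-depth bx))))
  ≼-comparable (≼-step _ ax) (≼-step _ bx) le = ≼-comparable ax bx le

  _≼?_ : ∀ a x → Dec (a ≼ x)
  a ≼? x = depth-ind (λ x → Dec (a ≼ x)) from-parent x
    where
    from-parent : ∀ x → (x ≢ ρ → Dec (a ≼ parent x)) → Dec (a ≼ x)
    from-parent x ih with a ≟ᶠ x | x ≟ᶠ ρ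
    ... | yes refl | _ = yes ≼-refl
    ... | no a≢x | yes refl = no λ aρ → proj₁ (≼-inv aρ a≢x) refl
    ... | no a≢x | no x≢ρ with ih x≢ρ
    ...   | yes ap = yes (≼-step x≢ρ ap)
    ...   | no ¬ap = no λ ax → ¬ap (proj₂ (≼-inv ax a≢x))

  siblings-disjoint : ∀ {c h p x} → ChildOf c p → ChildOf h p → c ≢ h → c ≼ x → h ≼ x → ⊥
  siblings-disjoint {c} {h} (c≢ρ , pc) (h≢ρ , ph) c≢h cx hx =
    c≢h (≼-depth-≡ (≼-comparable cx hx (≤-reflexive same)) (≤-reflexive (sym same)))
    where
    same : depth c ≡ depth h
    same = trans (depth-parent c c≢ρ) (trans (cong (λ z → suc (depth z)) (trans pc (sym ph)))
                                              (sym (depth-parent h h≢ρ)))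

  climb : ∀ {a y} → a ≼ y → Star (Inside T (λ z → a ≼ z × z ≼ y)) y a
  climb ≼-refl = ε
  climb (≼-step y≢ρ ay) =
    ((≼-step y≢ρ ay , ≼-refl) , (ay , parent-≼ y≢ρ) , adj-sym T (parent-adj _ y≢ρ)) ◅
    Star.map (inside-mono T (λ { (az , zp) → az , ≼-trans zp (parent-≼ y≢ρ) })) (climb ay)

  connect : ∀ {p a b} → p ≼ a → p ≼ b →
            Star (Inside T (λ z → p ≼ z × (z ≼ a ⊎ z ≼ b))) a b
  connect pa pb =
    Star.map (inside-mono T (λ { (pz , za) → pz , inj₁ za })) (climb pa) ◅◅
    Star.reverse (inside-sym T) (Star.map (inside-mono T (λ { (pz , zb) → pz , inj₂ zb })) (climb pb))

  rootRec : ∀ {A : Set} → (Fin n → A) → (Fin n → A → A) → Fin n → A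
  rootRec {A} base next v = go (depth v) v
    where
    go : ℕ → Fin n → A
    go zero v = base v
    go (suc f) v = next v (go f (parent v))

  rootRec-ρ : ∀ {A : Set} (base : Fin n → A) next → rootRec base next ρ ≡ base ρ
  rootRec-ρ base next rewrite depth-ρ = refl

  rootRec-parent : ∀ {A : Set} (base : Fin n → A) next {v} → v ≢ ρ →
                   rootRec base next v ≡ next v (rootRec base next (parent v))
  rootRec-parent base next {v} v≢ρ rewrite depth-parent v v≢ρ = refl

-- Weights and the three-subtree lemma

module Weights {n : ℕ} (T : Graph n) (tree : IsTree T) (D : PathDecomposition T) where
  open RootedTree T tree
  open Interval T D

  subtree : Fin n → Subset n
  subtree v = subsetOf (v ≼?_)

  count : Fin (PathDecomposition.m D) → Fin n → ℕ
  count i v = ∣ bagOf i ∩ subtree v ∣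

  opaque
    weight : Fin n → ℕ
    weight v = maxOver (λ i → count i v)

    count-≤-weight : ∀ i v → count i v ≤ₙ weight v
    count-≤-weight i v = ≤-maxOver (λ j → count j v) i

    weight-lub : ∀ v c → (∀ i → count i v ≤ₙ c) → weight v ≤ₙ c
    weight-lub v c = maxOver-lub (λ i → count i v) c

    weight-attained : ∀ v → ∃ λ i → weight v ≡ count i v
    weight-attained v = maxOver-attained (λ j → count j v) (proj₁ (PathDecomposition.cover D v))

  ∈-bag∩subtree : ∀ {i v x} → x ∈ˢ bagOf i → v ≼ x → x ∈ˢ bagOf i ∩ subtree v
  ∈-bag∩subtree {v = v} x∈ vx = x∈p∩q⁺ (x∈ , ∈-subsetOf⁺ (v ≼?_) vx)

  subtree-mono : ∀ {a b} → a ≼ b → ∀ {x} → x ∈ˢ subtree b → x ∈ˢ subtree a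
  subtree-mono {a} {b} ab x∈ = ∈-subsetOf⁺ (a ≼?_) (≼-trans ab (∈-subsetOf⁻ (b ≼?_) x∈))

  weight-mono : ∀ {a b} → a ≼ b → weight b ≤ₙ weight a
  weight-mono {a} {b} ab = weight-lub b (weight a)
    (λ i → ≤-trans (∣∩∣-mono (bagOf i) (subtree-mono ab)) (count-≤-weight i a))

  weight-≤-width : ∀ k → WidthAtMost T D k → ∀ v → weight v ≤ₙ suc k
  weight-≤-width k width v = weight-lub v (suc k) (λ i → ≤-trans (∣p∩q∣≤∣p∣ (bagOf i) (subtree v)) (width i))

  -- Every vertex lies in some bag, so its subtree meets that bag.
  weight-pos : ∀ v → 1 ≤ₙ weight v
  weight-pos v with PathDecomposition.cover D v
  ... | i , v∈ = ≤-trans (one≤∣∣ _ (∈-bag∩subtree v∈ ≼-refl)) (count-≤-weight i v)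

  -- A vertex with a child has weight at least two: the bag containing the
  -- edge to the child contains two vertices of its subtree.
  weight-≥2 : ∀ {c p} → ChildOf c p → 2 ≤ₙ weight p
  weight-≥2 {c} (c≢ρ , refl) with PathDecomposition.edges D (parent c) c (parent-adj c c≢ρ)
  ... | i , p∈ , c∈ = ≤-trans (two≤∣∣ _ (∈-bag∩subtree p∈ ≼-refl) (∈-bag∩subtree c∈ (parent-≼ c≢ρ)) c≢p)
                              (count-≤-weight i (parent c))
    where
    c≢p : c ≢ parent c
    c≢p e = child-⋠ (c≢ρ , refl) (subst (c ≼_) e ≼-refl)

  Full : Fin (PathDecomposition.m D) → Fin n → Set
  Full i x = count i x ≡ weight x

  full-nonempty : ∀ {i x} → Full i x → ∃ λ y → y ∈ˢ bagOf i × x ≼ y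
  full-nonempty {i} {x} full
    with 1≤∣∣⇒nonempty (bagOf i ∩ subtree x) (≤-trans (weight-pos x) (≤-reflexive (sym full)))
  ... | y , y∈ with x∈p∩q⁻ (bagOf i) (subtree x) y∈
  ...   | y∈bag , y∈subtree = y , y∈bag , ∈-subsetOf⁻ (x ≼?_) y∈subtree

  -- If x has the weight of its ancestor p, a bag full for x contains no other
  -- vertices of the subtree of p: they would push the count of p above its weight.
  full-bag-confined : ∀ {p x i} → p ≼ x → weight p ≡ weight x → Full i x →
                      ∀ {y} → p ≼ y → y ∈ˢ bagOf i → x ≼ y
  full-bag-confined {p} {x} {i} px same full {y} py y∈ with x ≼? y
  ... | yes xy = xy
  ... | no ¬xy = ⊥-elim (<-irrefl refl (≤-trans more (≤-trans (count-≤-weight i p) (≤-reflexive (trans same (sym full))))))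
    where
    more : count i x <ₙ count i p
    more = ∣∩∣-strict (bagOf i) (subtree-mono px) y∈ (∈-subsetOf⁺ (p ≼?_) py)
                      (λ y∈x → ¬xy (∈-subsetOf⁻ (x ≼?_) y∈x))

  -- The tree path between the subtrees of x and y avoids the subtree of z.
  Avoids : Fin n → Fin n → Fin n → Set
  Avoids x y z = ∀ {a b u} → x ≼ a → y ≼ b → u ≼ a ⊎ u ≼ b → z ≼ u → ⊥

  not-between : ∀ {p x y z i j l} → p ≼ x → p ≼ y → p ≼ z → weight p ≡ weight z →
                Full i x → Full l y → Full j z → Avoids x y z → ¬ Between i j l
  not-between px py pz same fi fl fj avoid btw with full-nonempty fi | full-nonempty fl
  ... | a , a∈ , xa | b , b∈ , yb
    with interval (connect (≼-trans px xa) (≼-trans py yb)) (≼-trans px xa , inj₁ ≼-refl) a∈ b∈ btw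
  ...   | u , (pu , on-path) , u∈ = avoid xa yb on-path (full-bag-confined pz same fj pu u∈)

  -- Three subtrees of the weight of a common ancestor p, each avoided by the
  -- path between the other two, are impossible: of three bags full for them
  -- one lies between the other two.
  three-subtrees : ∀ {p x₁ x₂ x₃} → p ≼ x₁ → p ≼ x₂ → p ≼ x₃ →
                   weight p ≡ weight x₁ → weight p ≡ weight x₂ → weight p ≡ weight x₃ →
                   Avoids x₁ x₂ x₃ → Avoids x₁ x₃ x₂ → Avoids x₂ x₃ x₁ → ⊥
  three-subtrees {x₁ = x₁} {x₂} {x₃} p₁ p₂ p₃ w₁ w₂ w₃ a₁₂ a₁₃ a₂₃
    with weight-attained x₁ | weight-attained x₂ | weight-attained x₃
  ... | i₁ , f₁ | i₂ , f₂ | i₃ , f₃ with some-between i₁ i₂ i₃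
  ...   | inj₁ btw = not-between p₁ p₃ p₂ w₂ (sym f₁) (sym f₃) (sym f₂) a₁₃ btw
  ...   | inj₂ (inj₁ btw) = not-between p₂ p₃ p₁ w₁ (sym f₂) (sym f₃) (sym f₁) a₂₃ btw
  ...   | inj₂ (inj₂ btw) = not-between p₁ p₂ p₃ w₃ (sym f₁) (sym f₂) (sym f₃) a₁₂ btw

  record SplitAbove (v : Fin n) : Set where
    field
      p c h    : Fin n
      c-child  : ChildOf c p
      h-child  : ChildOf h p
      c≢h      : c ≢ h
      c≼v      : c ≼ v
      p-weight : weight p ≡ weight v
      h-weight : weight h ≡ weight v

  -- After a split, a vertex has at most one child of its own weight: two such
  -- children c′, h′ together with h would form three separated subtrees.
  no-second-split : ∀ {v c′ h′} → SplitAbove v → ChildOf c′ v → ChildOf h′ v → c′ ≢ h′ →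
                    weight c′ ≡ weight v → weight h′ ≡ weight v → ⊥
  no-second-split {v} {c′} {h′} split c′-child h′-child c′≢h′ wc′ wh′ =
    three-subtrees (child-≼ h-child) (≼-trans pv (child-≼ h′-child)) (≼-trans pv (child-≼ c′-child))
                   (trans p-weight (sym h-weight)) (trans p-weight (sym wh′)) (trans p-weight (sym wc′))
                   avoid₁ avoid₂ avoid₃
    where
    open SplitAbove split
    pv : p ≼ v
    pv = ≼-trans (child-≼ c-child) c≼v
    -- The subtree of c contains everything below v, so it is disjoint from that of h.
    below-c : ∀ {y x} → v ≼ y → y ≼ x → c ≼ x
    below-c vy yx = ≼-trans c≼v (≼-trans vy yx)
    c-h-disjoint : ∀ {x} → c ≼ x → h ≼ x → ⊥
    c-h-disjoint = siblings-disjoint c-child h-child c≢h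
    c′-h′-disjoint : ∀ {x} → c′ ≼ x → h′ ≼ x → ⊥
    c′-h′-disjoint = siblings-disjoint c′-child h′-child c′≢h′
    avoid₁ : Avoids h h′ c′
    avoid₁ ha _ (inj₁ ua) c′u = c-h-disjoint (below-c (child-≼ c′-child) (≼-trans c′u ua)) ha
    avoid₁ _ h′b (inj₂ ub) c′u = c′-h′-disjoint (≼-trans c′u ub) h′b
    avoid₂ : Avoids h c′ h′
    avoid₂ ha _ (inj₁ ua) h′u = c-h-disjoint (below-c (child-≼ h′-child) (≼-trans h′u ua)) ha
    avoid₂ _ c′b (inj₂ ub) h′u = c′-h′-disjoint c′b (≼-trans h′u ub)
    avoid₃ : Avoids h′ c′ h
    avoid₃ h′a _ (inj₁ ua) hu = c-h-disjoint (below-c (child-≼ h′-child) h′a) (≼-trans hu ua)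
    avoid₃ _ c′b (inj₂ ub) hu = c-h-disjoint (below-c (child-≼ c′-child) c′b) (≼-trans hu ub)

  split-down : ∀ {v} → v ≢ ρ → weight v ≡ weight (parent v) → SplitAbove (parent v) → SplitAbove v
  split-down v≢ρ same split = record
    { p = p ; c = c ; h = h ; c-child = c-child ; h-child = h-child ; c≢h = c≢h
    ; c≼v = ≼-trans c≼v (parent-≼ v≢ρ)
    ; p-weight = trans p-weight (sym same) ; h-weight = trans h-weight (sym same) }
    where open SplitAbove split

-- Heavy children, heads and light depth

module HeavyChildren {n : ℕ} (T : Graph n) (tree : IsTree T) (D : PathDecomposition T) where
  open RootedTree T tree
  open Weights T tree D

  SameWeightChild : Fin n → Fin n → Set
  SameWeightChild v c = ChildOf c v × weight c ≡ weight v

  same-weight-child? : ∀ v c → Dec (SameWeightChild v c)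
  same-weight-child? v c = (¬? (c ≟ᶠ ρ) ×-dec (parent c ≟ᶠ v)) ×-dec (weight c ≟ weight v)

  opaque
    heavyChild : Fin n → Maybe (Fin n)
    heavyChild v = witness? (any? (same-weight-child? v))

    heavyChild-spec : ∀ v → (heavyChild v ≡ nothing × ¬ ∃ (SameWeightChild v))
                           ⊎ (∃ λ c → heavyChild v ≡ just c × SameWeightChild v c)
    heavyChild-spec v = witness?-spec (any? (same-weight-child? v))

  heavyChild-just : ∀ {v c} → heavyChild v ≡ just c → SameWeightChild v c
  heavyChild-just {v} e with heavyChild-spec v
  ... | inj₁ (none , _) = case trans (sym none) e of λ ()
  ... | inj₂ (c , e′ , s) = subst (SameWeightChild v) (just-injective (trans (sym e′) e)) s

  Heavy : Fin n → Set
  Heavy c = heavyChild (parent c) ≡ just c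

  heavyChild-heavy : ∀ {v c} → heavyChild v ≡ just c → Heavy c
  heavyChild-heavy {c = c} e = subst (λ z → heavyChild z ≡ just c) (sym (proj₂ (proj₁ (heavyChild-just e)))) e

  heavyChild-depth : ∀ {v c} → heavyChild v ≡ just c → depth c ≡ suc (depth v)
  heavyChild-depth e with heavyChild-just e
  ... | (c≢ρ , refl) , _ = depth-parent _ c≢ρ

  heavy? : ∀ c → Dec (Heavy c)
  heavy? c = ≡-dec _≟ᶠ_ (heavyChild (parent c)) (just c)

  heavy-≢ρ : ∀ {c} → Heavy c → c ≢ ρ
  heavy-≢ρ h = proj₁ (proj₁ (heavyChild-just h))

  heavy-weight : ∀ {c} → Heavy c → weight c ≡ weight (parent c)
  heavy-weight h = proj₂ (heavyChild-just h)

  heavy-sibling : ∀ {c} → c ≢ ρ → ¬ Heavy c → weight c ≡ weight (parent c) →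
                  ∃ λ h → Heavy h × parent h ≡ parent c × h ≢ c
  heavy-sibling {c} c≢ρ light same with heavyChild-spec (parent c)
  ... | inj₁ (_ , none) = ⊥-elim (none (c , (c≢ρ , refl) , same))
  ... | inj₂ (h , e , ((_ , ph) , _)) =
    h , subst (λ z → heavyChild z ≡ just h) (sym ph) e , ph , λ { refl → light e }

  -- The head of v: the top vertex of the maximal chain of heavy vertices
  -- ending at v.  Like the light depth below, it is used only through its
  -- recursive description, so it is kept opaque.
  opaque
    head : Fin n → Fin n
    head = rootRec (λ v → v) (λ v h → if does (heavy? v) then h else v)

    head-light : ∀ {v} → ¬ Heavy v → head v ≡ v
    head-light {v} light with v ≟ᶠ ρ
    ... | yes refl = rootRec-ρ _ _
    ... | no v≢ρ = trans (rootRec-parent _ _ v≢ρ)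
                         (cong (λ b → if b then head (parent v) else v) (dec-false (heavy? v) light))

    head-heavy : ∀ {v} → Heavy v → head v ≡ head (parent v)
    head-heavy {v} h = trans (rootRec-parent _ _ (heavy-≢ρ h))
                             (cong (λ b → if b then head (parent v) else v) (dec-true (heavy? v) h))

  -- The light depth of v: the number of light vertices other than ρ on its root path.
  opaque
    lightDepth : Fin n → ℕ
    lightDepth = rootRec (λ _ → 0) (λ v d → (if does (heavy? v) then 0 else 1) + d)

    lightDepth-ρ : lightDepth ρ ≡ 0
    lightDepth-ρ = rootRec-ρ _ _

    lightDepth-heavy : ∀ {v} → Heavy v → lightDepth v ≡ lightDepth (parent v)
    lightDepth-heavy {v} h = trans (rootRec-parent _ _ (heavy-≢ρ h))
      (cong (λ b → (if b then 0 else 1) + lightDepth (parent v)) (dec-true (heavy? v) h))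

    lightDepth-light : ∀ {v} → v ≢ ρ → ¬ Heavy v → lightDepth v ≡ suc (lightDepth (parent v))
    lightDepth-light {v} v≢ρ light = trans (rootRec-parent _ _ v≢ρ)
      (cong (λ b → (if b then 0 else 1) + lightDepth (parent v)) (dec-false (heavy? v) light))

  -- The potential of v; it controls the light depth since weights are positive.
  potential : Fin n → ℕ
  potential v = lightDepth v + (weight v + weight v)

  Bounded : Fin n → Set
  Bounded v = potential v ≤ₙ weight ρ + weight ρ
            ⊎ (potential v ≤ₙ suc (weight ρ + weight ρ) × SplitAbove v)

  bounded-weakly : ∀ {v} → Bounded v → potential v ≤ₙ suc (weight ρ + weight ρ)
  bounded-weakly (inj₁ b) = ≤-trans b (n≤1+n _)
  bounded-weakly (inj₂ (b , _)) = b

  potential-heavy : ∀ {v} → Heavy v → potential v ≡ potential (parent v)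
  potential-heavy h = cong₂ _+_ (lightDepth-heavy h) (cong (λ w → w + w) (heavy-weight h))

  bounded-heavy : ∀ {v} → Heavy v → Bounded (parent v) → Bounded v
  bounded-heavy h (inj₁ b) = inj₁ (≤-trans (≤-reflexive (potential-heavy h)) b)
  bounded-heavy h (inj₂ (b , split)) =
    inj₂ (≤-trans (≤-reflexive (potential-heavy h)) b , split-down (heavy-≢ρ h) (heavy-weight h) split)

  -- A light vertex of smaller weight pays for its extra light edge.
  bounded-lighter : ∀ {v} → v ≢ ρ → ¬ Heavy v → weight v <ₙ weight (parent v) →
                    Bounded (parent v) → Bounded v
  bounded-lighter {v} v≢ρ light lighter ih =
    inj₁ (subst (λ l → l + (weight v + weight v) ≤ₙ weight ρ + weight ρ) (sym (lightDepth-light v≢ρ light))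
                (potential-drop (lightDepth (parent v)) (weight v) (weight (parent v)) _ lighter (bounded-weakly ih)))

  potential-light-equal : ∀ {v} → v ≢ ρ → ¬ Heavy v → weight v ≡ weight (parent v) →
                          potential v ≡ suc (potential (parent v))
  potential-light-equal v≢ρ light same = cong₂ _+_ (lightDepth-light v≢ρ light) (cong (λ w → w + w) same)

  -- A light vertex of its parent's weight creates a split, which is only
  -- possible if there was none before.
  bounded-equal : ∀ {v} → v ≢ ρ → ¬ Heavy v → weight v ≡ weight (parent v) →
                  Bounded (parent v) → Bounded v
  bounded-equal {v} v≢ρ light same ih with heavy-sibling v≢ρ light same
  ... | h , heavy-h , ph , h≢v with ih
  ...   | inj₂ (_ , split) = ⊥-elim (no-second-split split (v≢ρ , refl) (heavy-≢ρ heavy-h , ph)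
                                       (λ e → h≢v (sym e)) same (trans (heavy-weight heavy-h) (cong weight ph)))
  ...   | inj₁ b = inj₂ (≤-trans (≤-reflexive (potential-light-equal v≢ρ light same)) (s≤s b) , record
                      { p = parent v ; c = v ; h = h ; c-child = v≢ρ , refl ; h-child = heavy-≢ρ heavy-h , ph
                      ; c≢h = λ e → h≢v (sym e) ; c≼v = ≼-refl ; p-weight = sym same
                      ; h-weight = trans (heavy-weight heavy-h) (trans (cong weight ph) (sym same)) })

  bounded : ∀ v → Bounded v
  bounded = depth-ind Bounded from-parent
    where
    from-parent : ∀ v → (v ≢ ρ → Bounded (parent v)) → Bounded v
    from-parent v ih with v ≟ᶠ ρ
    ... | yes refl = inj₁ (≤-reflexive (cong (_+ (weight ρ + weight ρ)) lightDepth-ρ))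
    ... | no v≢ρ with heavy? v
    ...   | yes h = bounded-heavy h (ih v≢ρ)
    ...   | no light with m≤n⇒m<n∨m≡n (weight-mono (parent-≼ v≢ρ))
    ...     | inj₁ lighter = bounded-lighter v≢ρ light lighter (ih v≢ρ)
    ...     | inj₂ same = bounded-equal v≢ρ light same (ih v≢ρ)

  lightDepth-bound : ∀ k → WidthAtMost T D k → ∀ v → lightDepth v ≤ₙ k + k
  lightDepth-bound k width v with bounded v
  ... | inj₁ b = height-estimate _ _ _ k 0 (weight-pos v) (weight-≤-width k width ρ) b
  ... | inj₂ (b , split) = height-estimate _ _ _ k 1 two (weight-≤-width k width ρ) b
    where
    open SplitAbove split
    two : 2 ≤ₙ weight v
    two = subst (2 ≤ₙ_) p-weight (weight-≥2 c-child)

-- The heavy-path partition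

index-unique : ∀ {A : Set} {xs : List A} → Unique xs → ∀ {y} (y∈ : y ∈ xs) i →
               Data.List.lookup xs i ≡ y → Any.index y∈ ≡ i
index-unique uq (here refl) zero e = refl
index-unique (x∉ ∷ uq) (here refl) (suc i) e = ⊥-elim (All.lookup x∉ (∈-lookup i) (sym e))
index-unique (x∉ ∷ uq) (there y∈) zero refl = ⊥-elim (All.lookup x∉ y∈ refl)
index-unique (x∉ ∷ uq) (there y∈) (suc i) e = cong suc (index-unique uq y∈ i e)

module HeavyPathPartition {n : ℕ} (T : Graph n) (tree : IsTree T) (D : PathDecomposition T) where
  open RootedTree T tree
  open HeavyChildren T tree D

  head-≼ : ∀ v → head v ≼ v
  head-≼ = depth-ind (λ v → head v ≼ v) from-parent
    where
    from-parent : ∀ v → (v ≢ ρ → head (parent v) ≼ parent v) → head v ≼ v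
    from-parent v ih with heavy? v
    ... | yes h = subst (_≼ v) (sym (head-heavy h)) (≼-trans (ih (heavy-≢ρ h)) (parent-≼ (heavy-≢ρ h)))
    ... | no light = subst (_≼ v) (sym (head-light light)) ≼-refl

  head-is-light : ∀ v → ¬ Heavy (head v)
  head-is-light = depth-ind (λ v → ¬ Heavy (head v)) from-parent
    where
    from-parent : ∀ v → (v ≢ ρ → ¬ Heavy (head (parent v))) → ¬ Heavy (head v)
    from-parent v ih with heavy? v
    ... | yes h = subst (λ z → ¬ Heavy z) (sym (head-heavy h)) (ih (heavy-≢ρ h))
    ... | no light = subst (λ z → ¬ Heavy z) (sym (head-light light)) light

  lightDepth-head : ∀ v → lightDepth (head v) ≡ lightDepth v
  lightDepth-head = depth-ind (λ v → lightDepth (head v) ≡ lightDepth v) from-parent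
    where
    from-parent : ∀ v → (v ≢ ρ → lightDepth (head (parent v)) ≡ lightDepth (parent v)) →
                  lightDepth (head v) ≡ lightDepth v
    from-parent v ih with heavy? v
    ... | yes h = trans (cong lightDepth (head-heavy h)) (trans (ih (heavy-≢ρ h)) (sym (lightDepth-heavy h)))
    ... | no light = cong lightDepth (head-light light)

  -- The parts are indexed by the light vertices, the tops of the heavy paths.
  tops : List (Fin n)
  tops = filter (λ t → ¬? (heavy? t)) (allFin n)

  tops-unique : Unique tops
  tops-unique = filter⁺ (λ t → ¬? (heavy? t)) (allFin⁺ n)

  head∈tops : ∀ v → head v ∈ tops
  head∈tops v = ∈-filter⁺ (λ t → ¬? (heavy? t)) (∈-allFin (head v)) (head-is-light v)

  Part : Set
  Part = Fin (length tops)

  top : Part → Fin n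
  top = Data.List.lookup tops

  top-light : ∀ x → ¬ Heavy (top x)
  top-light x = proj₂ (∈-filter⁻ (λ t → ¬? (heavy? t)) {xs = allFin n} (∈-lookup {xs = tops} x))

  partOf : Fin n → Part
  partOf v = Any.index (head∈tops v)

  top-partOf : ∀ v → top (partOf v) ≡ head v
  top-partOf v = sym (AnyP.lookup-index (head∈tops v))

  partOf-by-head : ∀ v x → head v ≡ top x → partOf v ≡ x
  partOf-by-head v x e = index-unique tops-unique (head∈tops v) x (sym e)

  partOf-top : ∀ x → partOf (top x) ≡ x
  partOf-top x = partOf-by-head (top x) x (head-light (top-light x))

  partOf-heavy : ∀ {v} → Heavy v → partOf v ≡ partOf (parent v)
  partOf-heavy {v} h = partOf-by-head v (partOf (parent v)) (trans (head-heavy h) (sym (top-partOf (parent v))))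

  same-part⇒same-head : ∀ {a b} → partOf a ≡ partOf b → head a ≡ head b
  same-part⇒same-head {a} {b} e = trans (sym (top-partOf a)) (trans (cong top e) (top-partOf b))

  chain : ℕ → Maybe (Fin n) → List (Fin n)
  chain zero _ = []
  chain (suc f) nothing = []
  chain (suc f) (just t) = t ∷ chain f (heavyChild t)

  chain-member : ∀ f {m u} → u ∈ chain f m → ∃ λ t → m ≡ just t × head u ≡ head t × t ≼ u
  chain-member (suc f) {just t} (here refl) = t , refl , refl , ≼-refl
  chain-member (suc f) {just t} (there u∈) with chain-member f u∈
  ... | c , e , hu , cu with heavyChild-just e
  ...   | c-child , _ = t , refl , trans hu (trans (head-heavy (heavyChild-heavy e)) (cong head (proj₂ c-child))) ,
                        ≼-trans (child-≼ c-child) cu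

  chain-unique : ∀ f m → Unique (chain f m)
  chain-unique zero _ = []
  chain-unique (suc f) nothing = []
  chain-unique (suc f) (just t) = All.tabulate t∉ ∷ chain-unique f (heavyChild t)
    where
    t∉ : ∀ {u} → u ∈ chain f (heavyChild t) → t ≢ u
    t∉ u∈ refl with chain-member f u∈
    ... | c , e , _ , c≼t = child-⋠ (proj₁ (heavyChild-just e)) c≼t

  chain-linked-from : ∀ f t → Linked (Adj T) (t ∷ chain f (heavyChild t))
  chain-linked-from zero t = [-]
  chain-linked-from (suc f) t with heavyChild t in e
  ... | nothing = [-]
  ... | just c with heavyChild-just e
  ...   | (c≢ρ , refl) , _ = parent-adj c c≢ρ ∷ chain-linked-from f c

  chain-linked : ∀ f m → Linked (Adj T) (chain f m)
  chain-linked zero _ = []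
  chain-linked (suc f) nothing = []
  chain-linked (suc f) (just t) = chain-linked-from f t

  chain-extend : ∀ f {t u c} → u ∈ chain f (just t) → heavyChild u ≡ just c →
                 depth c <ₙ depth t + f → c ∈ chain f (just t)
  chain-extend (suc zero) {t} (here refl) e lt =
    ⊥-elim (<-irrefl (trans (heavyChild-depth e) (+-comm 1 (depth t))) lt)
  chain-extend (suc (suc f)) (here refl) e lt = there (subst (λ m → _ ∈ chain (suc f) m) (sym e) (here refl))
  chain-extend (suc f) {t} {c = c} (there u∈) e lt with chain-member f u∈
  ... | c′ , e′ , _ , _ =
    there (subst (λ m → c ∈ chain f m) (sym e′)
            (chain-extend f (subst (λ m → _ ∈ chain f m) e′ u∈) e
              (subst (depth c <ₙ_) (trans (+-suc (depth t) f) (cong (_+ f) (sym (heavyChild-depth e′)))) lt)))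

  -- The heavy path of a top vertex t; it has at most 1 + max depth vertices.
  pathOf : Fin n → List (Fin n)
  pathOf t = chain (suc (maxOver depth)) (just t)

  pathOf-complete : ∀ t v → head v ≡ t → v ∈ pathOf t
  pathOf-complete t = depth-ind (λ v → head v ≡ t → v ∈ pathOf t) from-parent
    where
    from-parent : ∀ v → (v ≢ ρ → head (parent v) ≡ t → parent v ∈ pathOf t) → head v ≡ t → v ∈ pathOf t
    from-parent v ih e with heavy? v
    ... | no light with trans (sym (head-light light)) e
    ...   | refl = here refl
    from-parent v ih e | yes h =
      chain-extend _ (ih (heavy-≢ρ h) (trans (sym (head-heavy h)) e)) h
        (≤-trans (s≤s (≤-maxOver depth v)) (m≤n+m _ (depth t)))

  heavyPathPartition : PathPartition T
  heavyPathPartition = record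
    { m = length tops
    ; part = partOf
    ; isPath = λ x → pathOf (top x) , (s≤s z≤n , chain-unique _ _ , chain-linked _ _) ,
                     λ v → mk⇔ (on-path x v) (λ e → pathOf-complete (top x) v (trans (sym (top-partOf v)) (cong top e)))
    }
    where
    on-path : ∀ x v → v ∈ pathOf (top x) → partOf v ≡ x
    on-path x v v∈ with chain-member _ v∈
    ... | _ , refl , hv , _ = partOf-by-head v x (trans hv (head-light (top-light x)))

  𝒯 : Graph (length tops)
  𝒯 = quotient T heavyPathPartition

  parentPart : Part → Part
  parentPart x = partOf (parent (top x))

  level : Part → ℕ
  level x = lightDepth (top x)

  open ParentGraph 𝒯 parentPart level using (ParentOf)

  -- A tree edge between two parts joins a vertex to a light child, which is
  -- the top of its part.
  crossing-edge : ∀ {u v} → ChildOf v u → partOf u ≢ partOf v → ParentOf (partOf u) (partOf v)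
  crossing-edge {v = v} (v≢ρ , refl) different =
    cong (λ z → partOf (parent z)) (sym top-v) ,
    trans (cong lightDepth top-v)
          (trans (lightDepth-light v≢ρ light)
                 (cong suc (sym (trans (cong lightDepth (top-partOf (parent v))) (lightDepth-head (parent v))))))
    where
    light : ¬ Heavy v
    light h = different (sym (partOf-heavy h))
    top-v : top (partOf v) ≡ v
    top-v = trans (top-partOf v) (head-light light)

  edge-dir : ∀ {x y} → Adj 𝒯 x y → ParentOf x y ⊎ ParentOf y x
  edge-dir (x≢y , u , v , refl , refl , a) with tree-edge a
  ... | inj₁ u-child = inj₂ (crossing-edge u-child (λ e → x≢y (sym e)))
  ... | inj₂ v-child = inj₁ (crossing-edge v-child x≢y)

  𝒯-acyclic : Acyclic 𝒯
  𝒯-acyclic = ParentGraph.acyclic 𝒯 parentPart level edge-dir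

  walk-from-root : ∀ v → Walk 𝒯 (partOf ρ) (partOf v) (lightDepth v)
  walk-from-root = depth-ind (λ v → Walk 𝒯 (partOf ρ) (partOf v) (lightDepth v)) from-parent
    where
    from-parent : ∀ v → (v ≢ ρ → Walk 𝒯 (partOf ρ) (partOf (parent v)) (lightDepth (parent v))) →
                  Walk 𝒯 (partOf ρ) (partOf v) (lightDepth v)
    from-parent v ih with v ≟ᶠ ρ
    ... | yes refl = subst (Walk 𝒯 _ _) (sym lightDepth-ρ) here
    ... | no v≢ρ with heavy? v
    ...   | yes h = subst₂ (Walk 𝒯 (partOf ρ)) (sym (partOf-heavy h)) (sym (lightDepth-heavy h)) (ih v≢ρ)
    ...   | no light = subst (Walk 𝒯 _ _) (sym (lightDepth-light v≢ρ light))
                         (walk-snoc (ih v≢ρ) (different , parent v , v , refl , refl , parent-adj v v≢ρ))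
      where
      different : partOf (parent v) ≢ partOf v
      different e = child-⋠ (v≢ρ , refl)
        (subst (_≼ parent v) (trans (same-part⇒same-head e) (head-light light)) (head-≼ (parent v)))

  walk-to : ∀ x → Walk 𝒯 (partOf ρ) x (level x)
  walk-to x = subst (λ z → Walk 𝒯 (partOf ρ) z (level x)) (partOf-top x) (walk-from-root (top x))

  𝒯-connected : Connected 𝒯
  𝒯-connected x y = _ , walk-++ (walk-reverse (walk-to x)) (walk-to y)

-- Only a path decomposition of width at most k is needed:
-- the heavy-path partition of the tree rooted anywhere has a quotient tree,
-- rooted at the part of the root, of height at most the largest light depth,
-- which is at most 2k.

lemma1 : ∀ {n : ℕ} (T : Graph n) (k : ℕ) → IsTree T → PathwidthIs T k
       → HasPathPartitionOfHeightAtMost T (2 * k)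
lemma1 T k tree ((D , width) , _) =
  heavyPathPartition ,
  (≤-trans (s≤s z≤n) (toℕ<n (partOf ρ)) , 𝒯-connected , 𝒯-acyclic) ,
  partOf ρ ,
  λ x → level x , ≤-trans (lightDepth-bound k width (top x)) (≤-reflexive 2k) , walk-to x
  where
  open RootedTree T tree using (ρ)
  open HeavyChildren T tree D using (lightDepth-bound)
  open HeavyPathPartition T tree D
  2k : k + k ≡ 2 * k
  2k = cong (k +_) (sym (+-identityʳ k))
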